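{- Let $G^\tau=(V,E,\tau)$ be an edge-periodic graph, and let $Attr(F)$ be the attractor set of the final states in the reachability game $\beta(G^\tau)$ defined below. Then $G^\tau$ is cop-win if and only if there exists a vertex $v\in V$ such that $(v,r,\mathsf{C},0)\in Attr(F)$ for all $r\in V$.
   Context: For a positive integer $k$, $[k]=\{0,\dots,k-1\}$. An edge-periodic graph $G^\tau=(V,E,\tau)$ is a finite simple graph $(V,E)$ with time steps $t=0,1,2,\dots$ and a map $\tau$ assigning each edge $e$ a bit pattern $b_e(0)\cdots b_e(l_e-1)$ of length $l_e\ge1$ containing at least one $1$; $e$ is present in step $t$ iff $b_e(t\bmod l_e)=1$. Let $L=\{l_e:e\in E\}$ and $\mathsf{LCM}(L)$ its least common multiple. Game: the cop $\mathsf{C}$ chooses a start vertex, then the robber $\mathsf{R}$ (knowing it) chooses one; in each time step $t=0,1,2,\dots$, first $\mathsf{C}$ then $\mathsf{R}$ moves, each either staying put or traversing an incident edge present in step $t$, with full information. The cop wins as soon as both occupy the same vertex at the end of a move. $G^\tau$ is cop-win if the cop has a strategy guaranteeing a win, robber-win otherwise. Reachability game $\beta(G^\tau)$: states $V'=\{(c,r,s,t): c,r\in V, s\in\{\mathsf{C},\mathsf{R}\}, t\in[\mathsf{LCM}(L)]\}$, $V_0=\{(c,r,\mathsf{C},t)\}$ (cop-owned), $V_1=\{(c,r,\mathsf{R},t)\}$ (robber-owned), $F=\{(c,r,s,t): c=r\}$. There is a directed edge from $(c,r,s,t)$ to a different state $(c',r',s',t')$ iff: $s\neq s'$; if $s=\mathsf{C}$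 then ($c'=c$ or $\{c,c'\}\in E$ with $b_{\{c,c'\}}(t\bmod l_{\{c,c'\}})=1$), $r'=r$, $t'=t$; if $s=\mathsf{R}$ then ($r'=r$ or $\{r,r'\}\in E$ with $b_{\{r,r'\}}(t\bmod l_{\{r,r'\}})=1$), $c'=c$, $t'=(t+1)\bmod\mathsf{LCM}(L)$. Attractor: $Attr_0(F)=F$, $Attr_{i+1}(F)=Attr_i(F)\cup\{v\in V_0:\exists (v,u)\in E',\,u\in Attr_i(F)\}\cup\{v\in V_1:\forall (v,u)\in E',\,u\in Attr_i(F)\}$, and $Attr(F)=\bigcup_{i\ge0}Attr_i(F)$. -}

module Defs where

open import Data.Nat using (ℕ; zero; suc; _<_; _<?_; NonZero; nonZero)
open import Data.Nat.DivMod using (_mod_)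
open import Data.Nat.LCM using (lcm; lcm-least)
open import Data.Nat.Divisibility using (_∣_; m∣m*n; n∣m*n; 0∣⇒≡0)
open import Data.Nat.Properties using (m*n≡0⇒m≡0∨n≡0)
open import Data.Fin using (Fin; toℕ; fromℕ<)
open import Data.Bool using (Bool; true)
open import Data.Maybe using (Maybe; just; nothing)
open import Data.List using (List; []; _∷_; foldr; allFin; concatMap; map; length)
open import Data.Product using (Σ; ∃; _×_; _,_; proj₁; proj₂)
open import Data.Sum using (_⊎_; inj₁; inj₂)
open import Data.Empty using (⊥)
open import Relation.Nullary using (¬_; yes; no)
open import Relation.Binary.PropositionalEquality using (_≡_; _≢_; refl; subst)

record Pattern : Set where
  field
    pred-len : ℕ
    bits     : Fin (suc pred-len) → Bool
    hasOne   : ∃ λ i → bits i ≡ true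

  len : ℕ
  len = suc pred-len

bitAt : Pattern → ℕ → Bool
bitAt p t = Pattern.bits p (t mod Pattern.len p)

-- Vertices are Fin n.  pat u v = just p  iff  {u,v} ∈ E with τ({u,v}) = p.
-- Symmetry and irreflexivity make (V,E) a finite simple (undirected,
-- loopless) graph.
record EPGraph : Set where
  field
    n      : ℕ
    pat    : Fin n → Fin n → Maybe Pattern
    sym    : ∀ u v → pat u v ≡ pat v u
    irrefl : ∀ v → pat v v ≡ nothing

module _ (G : EPGraph) where
  open EPGraph G

  V : Set
  V = Fin n

  Present : ℕ → V → V → Set
  Present t u v = Σ Pattern λ p → (pat u v ≡ just p) × (bitAt p t ≡ true)

  Legal : ℕ → V → V → Set
  Legal t u w = (w ≡ u) ⊎ Present t u w

  lenOf : Maybe Pattern → ℕ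
  lenOf (just p) = Pattern.len p
  lenOf nothing  = 1

  -- the labels of all ordered pairs (each edge occurs twice, non-edges
  -- contribute 1; neither affects the lcm)
  allPats : List (Maybe Pattern)
  allPats = concatMap (λ u → map (pat u) (allFin n)) (allFin n)

  LCM : ℕ
  LCM = foldr lcm 1 (map lenOf allPats)

-- LCM(L) is nonzero (needed to have time 0 ∈ [LCM(L)])

private
  lcm-nz : ∀ a b → NonZero a → NonZero b → NonZero (lcm a b)
  lcm-nz (suc a) (suc b) _ _ with lcm (suc a) (suc b) | lcm-least {suc a} {suc b} (m∣m*n (suc b)) (n∣m*n (suc a))
  ... | zero  | d with m*n≡0⇒m≡0∨n≡0 (suc a) (0∣⇒≡0 d)
  ...   | inj₁ ()
  ...   | inj₂ ()
  lcm-nz (suc a) (suc b) _ _ | suc _ | _ = _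

  lenOf-nz : ∀ G m → NonZero (lenOf G m)
  lenOf-nz G (just p) = _
  lenOf-nz G nothing  = _

  fold-nz : ∀ G (xs : List (Maybe Pattern)) →
            NonZero (foldr lcm 1 (map (lenOf G) xs))
  fold-nz G []       = _
  fold-nz G (x ∷ xs) = lcm-nz _ _ (lenOf-nz G x) (fold-nz G xs)


LCM-nonZero : ∀ G → NonZero (LCM G)
LCM-nonZero G = fold-nz G (allPats G)

Time : EPGraph → Set
Time G = Fin (LCM G)

time0 : ∀ G → Time G
time0 G = _mod_ 0 (LCM G) {{LCM-nonZero G}}

nextTime : ∀ G → Time G → Time G
nextTime G t = _mod_ (suc (toℕ t)) (LCM G) {{LCM-nonZero G}}

module _ (G : EPGraph) where
  open EPGraph G

  -- A history is the current position (cop, robber) at the start of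
  -- time step t together with the list of earlier positions (most recent
  -- first); t = length of that list.
  Pos : Set
  Pos = V G × V G

  record CopStrategy : Set where
    field
      start : V G
      move  : Pos → List Pos → V G
      legal : ∀ cur past → Legal G (length past) (proj₁ cur) (move cur past)

  -- Robber strategy: initial vertex knowing the cop's, and a (legal)
  -- move depending on the whole history and the cop's move in this step.
  record RobberStrategy : Set where
    field
      start : V G → V G
      move  : V G → Pos → List Pos → V G
      legal : ∀ c′ cur past → Legal G (length past) (proj₂ cur) (move c′ cur past)

  play : CopStrategy → RobberStrategy → ℕ → Pos × List Pos
  play σ ρ zero =
    let c₀ = CopStrategy.start σ in (c₀ , RobberStrategy.start ρ c₀) , []
  play σ ρ (suc t) with play σ ρ t
  ... | cur , past =
    let c′ = CopStrategy.move σ cur past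
        r′ = RobberStrategy.move ρ c′ cur past
    in (c′ , r′) , (cur ∷ past)

  -- The cop wins the play iff at some time the two players occupy the
  -- same vertex at the end of a move: after the initial placement / a
  -- robber move (start of a step), or right after a cop move.
  CopWinsPlay : CopStrategy → RobberStrategy → Set
  CopWinsPlay σ ρ = ∃ λ t →
    let cur  = proj₁ (play σ ρ t)
        past = proj₂ (play σ ρ t)
    in (proj₁ cur ≡ proj₂ cur) ⊎ (CopStrategy.move σ cur past ≡ proj₂ cur)

  CopWin : Set
  CopWin = Σ CopStrategy λ σ → ∀ (ρ : RobberStrategy) → CopWinsPlay σ ρ

data Side : Set where
  C R : Side

module _ (G : EPGraph) where

  State : Set
  State = V G × V G × Side × Time G

  Final : State → Set
  Final (c , r , s , t) = c ≡ r

  Step : State → State → Set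
  Step x@(c , r , s , t) y@(c′ , r′ , s′ , t′) = (x ≢ y) × (s ≢ s′) × Cond s
    where
    Cond : Side → Set
    Cond C = Legal G (toℕ t) c c′ × (r′ ≡ r) × (t′ ≡ t)
    Cond R = Legal G (toℕ t) r r′ × (c′ ≡ c) × (t′ ≡ nextTime G t)

  Attr : ℕ → State → Set
  Attr zero    x = Final x
  Attr (suc i) x = Attr i x ⊎ Owned (proj₁ (proj₂ (proj₂ x)))
    where
    Owned : Side → Set
    Owned C = ∃ λ y → Step x y × Attr i y
    Owned R = ∀ y → Step x y → Attr i y

  InAttr : State → Set
  InAttr x = ∃ λ i → Attr i x

module Submission where

-- The proof rests on three general facts.
--   * Periodicity: whether an edge is present at step t only depends on
--     t mod LCM(L), so the game on G^τ is faithfully simulated by β(G^τ),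
--     whose clock runs modulo LCM(L).
--   * Stabilisation: β(G^τ) is finite and its attractor approximants are
--     decidable and increasing, so they stop growing at some stage N; hence
--     Attr(F) = Attr_N(F), which is decidable and closed under both attractor
--     rules.
--   * One-step unfolding: a state of rank i is final or (cop state) has a legal
--     move into rank i - 1, or (robber state) has all legal moves in rank i - 1.
-- The cop then wins from (v , r , C , 0) ∈ Attr_N by following the unfolding,
-- the rank budget N ∸ t forcing a capture by step N; conversely, from a state
-- outside Attr_N the robber always has a reply that stays outside Attr_N, so he
-- is never caught.

open import Defs
open import Data.Product using (∃; _,_)
open import Function.Bundles using (_⇔_; mk⇔)

open import Function using (id)
open import Data.Nat using (ℕ; zero; suc; pred; _+_; _*_; _∸_; _≤_; _≤′_; ≤′-refl; ≤′-step; z≤n; NonZero)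
open import Data.Nat.Properties using (≤⇒≯; ≤∧≢⇒<; ≤-<-trans; ≤⇒≤′; m≤m+n; pred[n]≤n; pred[m∸n]≡m∸[1+n]; n∸n≡0) renaming (_≟_ to _≟ℕ_)
open import Data.Nat.DivMod using (_mod_; _%_; _/_; m%n<n; m∣n⇒o%n%m≡o%m; [m+kn]%n≡m%n; m≡m%n+[m/n]*n)
open import Data.Nat.LCM using (lcm; m∣lcm[m,n]; n∣lcm[m,n])
open import Data.Nat.Divisibility using (_∣_; ∣-trans)
open import Data.Fin using (toℕ; _≟_)
open import Data.Fin.Properties using (toℕ-fromℕ<; fromℕ<-cong)
import Data.Fin.Properties as Fin
open import Data.Bool using (true)
import Data.Bool.Properties as Bool
open import Data.Maybe using (Maybe; just; nothing)
open import Data.Maybe.Properties using (just-injective)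
open import Data.List using (List; []; _∷_; foldr; allFin; map; length; filter; cartesianProduct)
open import Data.List.Properties using (length-filter)
import Data.List.Relation.Unary.All as All
import Data.List.Relation.Unary.Any as Any
open import Data.List.Membership.Propositional using (_∈_; lose)
open import Data.List.Membership.Propositional.Properties using (∈-map⁺; ∈-concatMap⁺; ∈-allFin; ∈-cartesianProduct⁺; ∈-filter⁺; ∈-filter⁻)
import Data.List.Relation.Binary.Sublist.Propositional as Sublist
open import Data.List.Relation.Binary.Sublist.Heterogeneous.Properties using (length-mono-≤; toPointwise; ⊆-filter-Sublist)
open import Data.List.Relation.Binary.Pointwise using (Pointwise-≡⇒≡)
open import Data.Product using (Σ; _×_; proj₁; proj₂)
open import Data.Product.Properties using (≡-dec)
open import Data.Sum using (_⊎_; inj₁; inj₂; [_,_]′)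
import Data.Sum as Sum
open import Relation.Nullary using (¬_; Dec; yes; no; contradiction)
open import Relation.Nullary.Decidable using (_×-dec_; _⊎-dec_; _→-dec_; ¬?; map′; decidable-stable)
open import Level using (0ℓ)
open import Relation.Unary using (Pred; Decidable; _⊆_)
open import Relation.Binary.PropositionalEquality using (_≡_; refl; sym; trans; cong; subst; subst₂; module ≡-Reasoning)

plateau : (f : ℕ → ℕ) (b : ℕ) → (∀ i → f i ≤ f (suc i)) → (∀ i → f i ≤ b) →
          ∃ λ i → f (suc i) ≡ f i
plateau f b f-mono f-bounded =
  [ id , (λ sb≤f → contradiction sb≤f (≤⇒≯ (f-bounded (suc b)))) ]′ (climb (suc b))
  where
  climb : ∀ k → (∃ λ i → f (suc i) ≡ f i) ⊎ (k ≤ f k)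
  climb zero = inj₂ z≤n
  climb (suc k) with climb k
  ... | inj₁ found = inj₁ found
  ... | inj₂ k≤fk with f (suc k) ≟ℕ f k
  ...   | yes flat = inj₁ (k , flat)
  ...   | no rise  = inj₂ (≤-<-trans k≤fk (≤∧≢⇒< (f-mono k) (λ e → rise (sym e))))

module Enumerated {A : Set} (xs : List A) (complete : ∀ x → x ∈ xs) where

  all? : {P : Pred A 0ℓ} → Decidable P → Dec (∀ x → P x)
  all? P? = map′ (λ ps x → All.lookup ps (complete x))
                 (λ ps → All.tabulate (λ {x} _ → ps x))
                 (All.all? P? xs)

  any? : {P : Pred A 0ℓ} → Decidable P → Dec (∃ P)
  any? P? = map′ Any.satisfied (λ (x , px) → lose (complete x) px) (Any.any? P? xs)

  count : {P : Pred A 0ℓ} → Decidable P → ℕ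
  count P? = length (filter P? xs)

  module _ {P Q : Pred A 0ℓ} (P? : Decidable P) (Q? : Decidable Q) (P⊆Q : P ⊆ Q) where

    filter-sublist : filter P? xs Sublist.⊆ filter Q? xs
    filter-sublist = ⊆-filter-Sublist P? Q? {as = xs} (λ { refl → P⊆Q }) Sublist.⊆-refl

    count-mono : count P? ≤ count Q?
    count-mono = length-mono-≤ {as = filter P? xs} filter-sublist

    same-count⇒⊇ : count P? ≡ count Q? → Q ⊆ P
    same-count⇒⊇ same {x} qx = proj₂ (∈-filter⁻ P? {xs = xs} x∈P)
      where
      x∈P : x ∈ filter P? xs
      x∈P = subst (x ∈_) (sym (Pointwise-≡⇒≡ (toPointwise same filter-sublist)))
                  (∈-filter⁺ Q? (complete x) qx)

  chain-stabilises : (P : ℕ → Pred A 0ℓ) → (∀ i → Decidable (P i)) →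
                     (∀ i → P i ⊆ P (suc i)) → ∃ λ N → P (suc N) ⊆ P N
  chain-stabilises P P? grows =
    let N , flat = plateau (λ i → count (P? i)) (length xs)
                           (λ i → count-mono (P? i) (P? (suc i)) (grows i))
                           (λ i → length-filter (P? i) xs)
    in N , same-count⇒⊇ (P? N) (P? (suc N)) (grows N) (sym flat)

module _ (G : EPGraph) where
  open EPGraph G using (n; pat)

  private
    instance
      LCM≢0 : NonZero (LCM G)
      LCM≢0 = LCM-nonZero G

  phase : ℕ → Time G
  phase t = t mod LCM G

  -- Periodicity: every pattern length divides LCM(L), so presence of edges,
  -- and hence legality of moves, only depends on the phase.
  private
    length∣fold : ∀ ms {m} → m ∈ ms → lenOf G m ∣ foldr lcm 1 (map (lenOf G) ms)
    length∣fold (m ∷ ms) (Any.here refl) = m∣lcm[m,n] _ _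
    length∣fold (m ∷ ms) (Any.there m∈ms) = ∣-trans (length∣fold ms m∈ms) (n∣lcm[m,n] (lenOf G m) _)

    pat∈allPats : ∀ u w → pat u w ∈ allPats G
    pat∈allPats u w = ∈-concatMap⁺ (λ u′ → map (pat u′) (allFin n))
                        (Any.map (λ { refl → ∈-map⁺ (pat u) (∈-allFin w) }) (∈-allFin u))

  length∣LCM : ∀ {u w p} → pat u w ≡ just p → Pattern.len p ∣ LCM G
  length∣LCM {u} {w} e = subst (λ m → lenOf G m ∣ LCM G) e (length∣fold (allPats G) (pat∈allPats u w))

  bitAt-phase : ∀ {u w p} t → pat u w ≡ just p → bitAt p (toℕ (phase t)) ≡ bitAt p t
  bitAt-phase {p = p} t e = cong (Pattern.bits p) (fromℕ<-cong _ _ same-residue _ _)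
    where
    same-residue : toℕ (phase t) % Pattern.len p ≡ t % Pattern.len p
    same-residue = trans (cong (_% Pattern.len p) (toℕ-fromℕ< (m%n<n t (LCM G))))
                         (m∣n⇒o%n%m≡o%m (Pattern.len p) (LCM G) t (length∣LCM e))

  legal-phase : ∀ {t u w} → Legal G t u w → Legal G (toℕ (phase t)) u w
  legal-phase {t} = Sum.map₂ λ (p , e , b) → p , e , trans (bitAt-phase t e) b

  legal-unphase : ∀ {t u w} → Legal G (toℕ (phase t)) u w → Legal G t u w
  legal-unphase {t} = Sum.map₂ λ (p , e , b) → p , e , trans (sym (bitAt-phase t e)) b

  nextTime-phase : ∀ t → nextTime G (phase t) ≡ phase (suc t)
  nextTime-phase t = fromℕ<-cong _ _ residue _ _
    where
    open ≡-Reasoning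
    L = LCM G
    residue : suc (toℕ (phase t)) % L ≡ suc t % L
    residue = begin
      suc (toℕ (phase t)) % L          ≡⟨ cong (λ k → suc k % L) (toℕ-fromℕ< (m%n<n t L)) ⟩
      suc (t % L) % L                  ≡⟨ sym ([m+kn]%n≡m%n (suc (t % L)) (t / L) L) ⟩
      suc (t % L + t / L * L) % L      ≡⟨ cong (λ k → suc k % L) (sym (m≡m%n+[m/n]*n t L)) ⟩
      suc t % L                        ∎

  present? : ∀ t u w → Dec (Present G t u w)
  present? t u w = by-label (pat u w) refl
    where
    by-label : (m : Maybe Pattern) → pat u w ≡ m → Dec (Present G t u w)
    by-label nothing  e = no λ (p , e′ , _) → contradiction (trans (sym e) e′) λ ()
    by-label (just p) e = map′ (λ b → p , e , b)
                               (λ (q , e′ , b) → subst (λ q → bitAt q t ≡ true) (just-injective (trans (sym e′) e)) b)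
                               (bitAt p t Bool.≟ true)

  legal? : ∀ t u w → Dec (Legal G t u w)
  legal? t u w = (w ≟ u) ⊎-dec present? t u w

  side-≟ : (s s′ : Side) → Dec (s ≡ s′)
  side-≟ C C = yes refl
  side-≟ C R = no λ ()
  side-≟ R C = no λ ()
  side-≟ R R = yes refl

  state-≟ : (x y : State G) → Dec (x ≡ y)
  state-≟ = ≡-dec _≟_ (≡-dec _≟_ (≡-dec side-≟ _≟_))

  step? : ∀ x y → Dec (Step G x y)
  step? x@(c , r , C , t) y@(c′ , r′ , s′ , t′) =
    ¬? (state-≟ x y) ×-dec ¬? (side-≟ C s′) ×-dec legal? (toℕ t) c c′ ×-dec r′ ≟ r ×-dec t′ ≟ t
  step? x@(c , r , R , t) y@(c′ , r′ , s′ , t′) =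
    ¬? (state-≟ x y) ×-dec ¬? (side-≟ R s′) ×-dec legal? (toℕ t) r r′ ×-dec c′ ≟ c ×-dec t′ ≟ nextTime G t

  states : List (State G)
  states = cartesianProduct (allFin n) (cartesianProduct (allFin n) (cartesianProduct (C ∷ R ∷ []) (allFin (LCM G))))

  states-complete : ∀ x → x ∈ states
  states-complete (c , r , s , t) =
    ∈-cartesianProduct⁺ (∈-allFin c) (∈-cartesianProduct⁺ (∈-allFin r) (∈-cartesianProduct⁺ (side∈ s) (∈-allFin t)))
    where
    side∈ : ∀ s → s ∈ C ∷ R ∷ []
    side∈ C = Any.here refl
    side∈ R = Any.there (Any.here refl)

  open Enumerated states states-complete using (all?; any?; chain-stabilises)

  attr? : ∀ i → Decidable (Attr G i)
  attr? zero    (c , r , s , t) = c ≟ r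
  attr? (suc i) x@(c , r , C , t) = attr? i x ⊎-dec any? (λ y → step? x y ×-dec attr? i y)
  attr? (suc i) x@(c , r , R , t) = attr? i x ⊎-dec all? (λ y → step? x y →-dec attr? i y)

  attr-mono : ∀ {i j x} → i ≤ j → Attr G i x → Attr G j x
  attr-mono i≤j = along (≤⇒≤′ i≤j)
    where
    along : ∀ {i j x} → i ≤′ j → Attr G i x → Attr G j x
    along ≤′-refl       a = a
    along (≤′-step i≤j) a = inj₁ (along i≤j a)

  cop-unfold : ∀ i {c r t} → Attr G i (c , r , C , t) →
               (c ≡ r) ⊎ ∃ λ c′ → Legal G (toℕ t) c c′ × Attr G (pred i) (c′ , r , R , t)
  cop-unfold zero    caught = inj₁ caught
  cop-unfold (suc i) (inj₁ a) = Sum.map₂ (λ (c′ , l , a′) → c′ , l , attr-mono pred[n]≤n a′) (cop-unfold i a)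
  cop-unfold (suc i) (inj₂ ((c′ , _ , C , _) , (_ , C≢C , _) , _)) = contradiction refl C≢C
  cop-unfold (suc i) (inj₂ ((c′ , _ , R , _) , (_ , _ , l , refl , refl) , a′)) = inj₂ (c′ , l , a′)

  robber-unfold : ∀ i {c r t} → Attr G i (c , r , R , t) →
                  (c ≡ r) ⊎ (∀ r′ → Legal G (toℕ t) r r′ → Attr G (pred i) (c , r′ , C , nextTime G t))
  robber-unfold zero    caught = inj₁ caught
  robber-unfold (suc i) (inj₁ a) = Sum.map₂ (λ all r′ l → attr-mono pred[n]≤n (all r′ l)) (robber-unfold i a)
  robber-unfold (suc i) (inj₂ all) = inj₂ λ r′ l → all _ ((λ ()) , (λ ()) , l , refl , refl)

  cop-enters : ∀ i {c c′ r t} → Legal G (toℕ t) c c′ → Attr G i (c′ , r , R , t) → Attr G (suc i) (c , r , C , t)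
  cop-enters i l a = inj₂ (_ , ((λ ()) , (λ ()) , l , refl , refl) , a)

  robber-trapped : ∀ i {c r t} → (∀ r′ → Legal G (toℕ t) r r′ → Attr G i (c , r′ , C , nextTime G t)) →
                   Attr G (suc i) (c , r , R , t)
  robber-trapped i all = inj₂ λ where
    (_ , _ , C , _) (_ , _ , l , refl , refl) → all _ l
    (_ , _ , R , _) (_ , R≢R , _) → contradiction refl R≢R

  Closed : ℕ → Set
  Closed i = Attr G (suc i) ⊆ Attr G i

  closed-suc : ∀ {i} → Closed i → Closed (suc i)
  closed-suc closed (inj₁ a) = a
  closed-suc closed {c , r , C , t} (inj₂ (y , step , a)) = inj₂ (y , step , closed a)
  closed-suc closed {c , r , R , t} (inj₂ all) = inj₂ λ y step → closed (all y step)

  -- the stage at which the attractor stops growing; kept opaque since only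
  -- its existence is used and unfolding it would make type checking expensive
  opaque
    stable : ∃ Closed
    stable = chain-stabilises (Attr G) attr? (λ i → inj₁)

  N : ℕ
  N = proj₁ stable

  attr-closed : Closed N
  attr-closed = proj₂ stable

  attr-bounded : ∀ {x} → InAttr G x → Attr G N x
  attr-bounded (i , a) = collapse i (attr-mono (m≤m+n i N) a)
    where
    closed-from : ∀ k → Closed (k + N)
    closed-from zero    = attr-closed
    closed-from (suc k) = closed-suc (closed-from k)
    collapse : ∀ k {x} → Attr G (k + N) x → Attr G N x
    collapse zero    a = a
    collapse (suc k) a = collapse k (closed-from k a)

  history-length : ∀ (σ : CopStrategy G) (ρ : RobberStrategy G) t → length (proj₂ (play G σ ρ t)) ≡ t
  history-length σ ρ zero    = refl
  history-length σ ρ (suc t) = cong suc (history-length σ ρ t)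

  -- With a history of length
  -- t the cop keeps the state inside Attr_(N ∸ t); each round costs at least
  -- one unit of this budget, so the robber is caught by step N.
  module CopFollowsAttractor (v : V G) (v-wins : ∀ r → Attr G N (v , r , C , phase 0)) where

    Advice : ℕ → V G → V G → Time G → Set
    Advice i c r t = Σ (V G) λ c′ → Legal G (toℕ t) c c′ ×
                       (Attr G i (c , r , C , t) → (c ≡ r) ⊎ Attr G (pred i) (c′ , r , R , t))

    advice : ∀ i c r t → Advice i c r t
    advice i c r t with attr? i (c , r , C , t)
    ... | no ¬a = c , inj₁ refl , λ a → contradiction a ¬a
    ... | yes a with cop-unfold i a
    ...   | inj₁ caught          = c , inj₁ refl , λ _ → inj₁ caught
    ...   | inj₂ (c′ , l , a′)   = c′ , l , λ _ → inj₂ a′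

    Budget : List (Pos G) → ℕ
    Budget past = N ∸ length past

    advised : ∀ (cur : Pos G) (past : List (Pos G)) → Advice (Budget past) (proj₁ cur) (proj₂ cur) (phase (length past))
    advised (c , r) past = advice (Budget past) c r (phase (length past))

    σ : CopStrategy G
    σ = record { start = v
               ; move  = λ cur past → proj₁ (advised cur past)
               ; legal = λ cur past → legal-unphase (proj₁ (proj₂ (advised cur past))) }

    OnTrack : Pos G × List (Pos G) → Set
    OnTrack ((c , r) , past) = Attr G (Budget past) (c , r , C , phase (length past))

    Caught : Pos G → List (Pos G) → Set
    Caught cur past = (proj₁ cur ≡ proj₂ cur) ⊎ (CopStrategy.move σ cur past ≡ proj₂ cur)

    spend : ∀ {c r} t → Attr G (pred (pred (N ∸ t))) (c , r , C , nextTime G (phase t)) →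
            Attr G (N ∸ suc t) (c , r , C , phase (suc t))
    spend {c} {r} t a = subst₂ (λ i τ → Attr G i (c , r , C , τ))
                               (pred[m∸n]≡m∸[1+n] N t) (nextTime-phase t) (attr-mono pred[n]≤n a)

    round : ∀ (ρ : RobberStrategy G) (cur : Pos G) (past : List (Pos G)) → OnTrack (cur , past) →
            let c′ = CopStrategy.move σ cur past
            in Caught cur past ⊎ OnTrack ((c′ , RobberStrategy.move ρ c′ cur past) , cur ∷ past)
    round ρ (c , r) past a with proj₂ (proj₂ (advised (c , r) past)) a
    ... | inj₁ caught = inj₁ (inj₁ caught)
    ... | inj₂ a′ with robber-unfold _ a′
    ...   | inj₁ caught = inj₁ (inj₂ caught)
    ...   | inj₂ all = inj₂ (spend (length past) (all _ (legal-phase (RobberStrategy.legal ρ _ (c , r) past))))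

    on-track : ∀ (ρ : RobberStrategy G) t → CopWinsPlay G σ ρ ⊎ OnTrack (play G σ ρ t)
    on-track ρ zero    = inj₂ (v-wins (RobberStrategy.start ρ v))
    on-track ρ (suc t) with on-track ρ t
    ... | inj₁ win = inj₁ win
    ... | inj₂ a   = Sum.map₁ (λ caught → t , caught) (round ρ (proj₁ (play G σ ρ t)) (proj₂ (play G σ ρ t)) a)

    -- at step N the budget is exhausted, so the invariant means capture
    wins : ∀ (ρ : RobberStrategy G) → CopWinsPlay G σ ρ
    wins ρ with on-track ρ N
    ... | inj₁ win = win
    ... | inj₂ a   = N , inj₁ (subst (λ i → Attr G i (c , r , C , phase (length past))) budget-spent a)
      where
      c    = proj₁ (proj₁ (play G σ ρ N))
      r    = proj₂ (proj₁ (play G σ ρ N))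
      past = proj₂ (play G σ ρ N)
      budget-spent : N ∸ length past ≡ 0
      budget-spent = trans (cong (N ∸_) (history-length σ ρ N)) (n∸n≡0 N)

  -- The robber strategy against a cop whose start leaves some robber start
  -- r₀ outside Attr_N: the robber keeps the state outside Attr_N forever.
  module RobberEvades (σ : CopStrategy G) (r₀ : V G)
                      (r₀-escapes : ¬ Attr G N (CopStrategy.start σ , r₀ , C , phase 0)) where

    cop-stays-out : ∀ {c c′ r t} → ¬ Attr G N (c , r , C , t) → Legal G (toℕ t) c c′ → ¬ Attr G N (c′ , r , R , t)
    cop-stays-out out l a = out (attr-closed (cop-enters N l a))

    Reply : ℕ → V G → V G → Set
    Reply t c′ r = Σ (V G) λ r′ → Legal G t r r′ ×
                     (¬ Attr G N (c′ , r , R , phase t) → ¬ Attr G N (c′ , r′ , C , phase (suc t)))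

    reply : ∀ t c′ r → Reply t c′ r
    reply t c′ r with Fin.any? (λ r′ → legal? (toℕ (phase t)) r r′ ×-dec ¬? (attr? N (c′ , r′ , C , nextTime G (phase t))))
    ... | yes (r′ , l , out) = r′ , legal-unphase l , λ _ → subst (λ τ → ¬ Attr G N (c′ , r′ , C , τ)) (nextTime-phase t) out
    ... | no none = r , inj₁ refl , λ out → contradiction (attr-closed (robber-trapped N trapped)) out
      where
      trapped : ∀ r′ → Legal G (toℕ (phase t)) r r′ → Attr G N (c′ , r′ , C , nextTime G (phase t))
      trapped r′ l = decidable-stable (attr? N _) λ out → none (r′ , l , out)

    replied : ∀ c′ (cur : Pos G) (past : List (Pos G)) → Reply (length past) c′ (proj₂ cur)
    replied c′ (c , r) past = reply (length past) c′ r

    ρ : RobberStrategy G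
    ρ = record { start = λ _ → r₀
               ; move  = λ c′ cur past → proj₁ (replied c′ cur past)
               ; legal = λ c′ cur past → proj₁ (proj₂ (replied c′ cur past)) }

    Evading : Pos G × List (Pos G) → Set
    Evading ((c , r) , past) = ¬ Attr G N (c , r , C , phase (length past))

    evading : ∀ t → Evading (play G σ ρ t)
    evading zero    = r₀-escapes
    evading (suc t) = proj₂ (proj₂ (replied (CopStrategy.move σ cur past) cur past))
                            (cop-stays-out (evading t) (legal-phase (CopStrategy.legal σ cur past)))
      where
      cur  = proj₁ (play G σ ρ t)
      past = proj₂ (play G σ ρ t)

    -- final states lie in Attr_N, so the robber is never caught
    never-caught : ¬ CopWinsPlay G σ ρ
    never-caught (t , inj₁ caught) = evading t (attr-mono z≤n caught)
    never-caught (t , inj₂ caught) =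
      cop-stays-out (evading t) (legal-phase (CopStrategy.legal σ cur past)) (attr-mono z≤n caught)
      where
      cur  = proj₁ (play G σ ρ t)
      past = proj₂ (play G σ ρ t)

lemma8 : (G : EPGraph) →
    CopWin G ⇔ (∃ λ (v : V G) → ∀ (r : V G) → InAttr G (v , r , C , time0 G))
lemma8 G = mk⇔ cop-win⇒attractor attractor⇒cop-win
  where
  -- a winning cop start is in Attr_N against every robber start: otherwise
  -- the robber evades the winning strategy
  cop-win⇒attractor : CopWin G → ∃ λ v → ∀ r → InAttr G (v , r , C , time0 G)
  cop-win⇒attractor (σ , σ-wins) = CopStrategy.start σ , λ r →
    N G , decidable-stable (attr? G (N G) _) λ out →
      RobberEvades.never-caught G σ r out (σ-wins (RobberEvades.ρ G σ r out))

  attractor⇒cop-win : (∃ λ v → ∀ r → InAttr G (v , r , C , time0 G)) → CopWin G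
  attractor⇒cop-win (v , v-wins) =
    CopFollowsAttractor.σ G v (λ r → attr-bounded G (v-wins r)) ,
    CopFollowsAttractor.wins G v (λ r → attr-bounded G (v-wins r))
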